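{- Let $A$ be a finite alphabet, $\phi\colon A^*\to A^*$ a $k$-uniform morphism and $h\colon A\to B$ a coding. For $l\in\mathbb{N}$ let $\sim_l$ be the equivalence relation on $A$ defined by $b\sim_l c$ iff $h(\phi^l(b))=h(\phi^l(c))$. If $\sim_r$ equals $\sim_t$ for some $r,t\in\mathbb{N}$, then $\sim_{r+p}$ equals $\sim_{t+p}$ for all $p\in\mathbb{N}$.
   Context: A morphism satisfies $\phi(uv)=\phi(u)\phi(v)$; it is $k$-uniform if $|\phi(a)|=k$ for each $a\in A$. A coding is a map $h\colon A\to B$ between finite alphabets, extended letterwise to words. -}

module Defs where

open import Data.Nat using (ℕ; zero; suc)
open import Data.Fin using (Fin)
open import Data.List using (List; []; _∷_; _++_; concatMap; map; [_])
open import Data.Vec using (Vec; toList)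
open import Data.Product using (_×_)
open import Relation.Binary.PropositionalEquality using (_≡_)

UniformMorphism : ℕ → ℕ → Set
UniformMorphism n k = Fin n → Vec (Fin n) k

apply : ∀ {n k} → UniformMorphism n k → List (Fin n) → List (Fin n)
apply φ w = concatMap (λ a → toList (φ a)) w

iter : ∀ {n k} → UniformMorphism n k → ℕ → List (Fin n) → List (Fin n)
iter φ zero w = w
iter φ (suc l) w = apply φ (iter φ l w)

code : ∀ {n m} → (Fin n → Fin m) → List (Fin n) → List (Fin m)
code h = map h

Sim : ∀ {n m k} → UniformMorphism n k → (Fin n → Fin m) → ℕ → Fin n → Fin n → Set
Sim φ h l b c = code h (iter φ l [ b ]) ≡ code h (iter φ l [ c ])

SameRel : ∀ {n} → (Fin n → Fin n → Set) → (Fin n → Fin n → Set) → Set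
SameRel R S = ∀ b c → (R b c → S b c) × (S b c → R b c)

-- The coded image h(φ^(l+1)(b)) is the concatenation of the blocks h(φ^l(x)) over the letters x of
-- φ(b), and all these blocks have the same length k^l.  Hence b ∼_(l+1) c holds iff φ(b) and φ(c)
-- agree letterwise up to ∼_l, so ∼_(l+1) is a function of ∼_l and the claim follows by induction on p.
module Submission where

open import Defs
open import Data.Nat using (ℕ; zero; suc; _+_; _*_; _^_)
open import Data.Nat.Properties using (+-comm; *-assoc; *-suc; *-zeroʳ; *-identityˡ; suc-injective)
open import Data.Fin using (Fin)
open import Data.List using (List; []; _∷_; _++_; concatMap; map; [_]; length)
open import Data.List.Properties
  using (∷-injective; ++-identityʳ; length-++; length-map; map-concatMap; concatMap-++)
open import Data.Vec using (Vec; toList) renaming ([] to []ᵥ; _∷_ to _∷ᵥ_)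
open import Data.Vec.Properties using (length-toList)
open import Data.Vec.Relation.Binary.Pointwise.Inductive using (Pointwise; []; _∷_)
import Data.Vec.Relation.Binary.Pointwise.Inductive as Pointwise
open import Data.Product using (_×_; _,_; proj₁; proj₂)
open import Relation.Binary.PropositionalEquality
  using (_≡_; refl; sym; trans; cong; cong₂; module ≡-Reasoning)

private
  variable
    A B : Set
    n m k : ℕ

++-injective-sameLength : (xs ys : List A) {us vs : List A} → length xs ≡ length ys →
                          xs ++ us ≡ ys ++ vs → xs ≡ ys × us ≡ vs
++-injective-sameLength []       []       _   eq = refl , eq
++-injective-sameLength (x ∷ xs) (y ∷ ys) len eq with ∷-injective eq
... | refl , eq′ with ++-injective-sameLength xs ys (suc-injective len) eq′
...   | refl , us≡vs = refl , us≡vs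

module _ (f : A → List B) where

  concatMap-toList-cong : ∀ {j} {u v : Vec A j} → Pointwise (λ a b → f a ≡ f b) u v →
                          concatMap f (toList u) ≡ concatMap f (toList v)
  concatMap-toList-cong []            = refl
  concatMap-toList-cong (fa≡fb ∷ u∼v) = cong₂ _++_ fa≡fb (concatMap-toList-cong u∼v)

  concatMap-toList-injective : (∀ a b → length (f a) ≡ length (f b)) →
                               ∀ {j} (u v : Vec A j) → concatMap f (toList u) ≡ concatMap f (toList v) →
                               Pointwise (λ a b → f a ≡ f b) u v
  concatMap-toList-injective _   []ᵥ       []ᵥ       _  = []
  concatMap-toList-injective len (a ∷ᵥ u) (b ∷ᵥ v) eq
    with ++-injective-sameLength (f a) (f b) (len a b) eq
  ... | fa≡fb , rest = fa≡fb ∷ concatMap-toList-injective len u v rest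

module _ (φ : UniformMorphism n k) where

  apply-++ : (u v : List (Fin n)) → apply φ (u ++ v) ≡ apply φ u ++ apply φ v
  apply-++ = concatMap-++ (λ a → toList (φ a))

  iter-++ : ∀ l (u v : List (Fin n)) → iter φ l (u ++ v) ≡ iter φ l u ++ iter φ l v
  iter-++ zero    u v = refl
  iter-++ (suc l) u v = trans (cong (apply φ) (iter-++ l u v)) (apply-++ (iter φ l u) (iter φ l v))

  iter-[] : ∀ l → iter φ l [] ≡ []
  iter-[] zero    = refl
  iter-[] (suc l) = cong (apply φ) (iter-[] l)

  iter-concatMap : ∀ l (w : List (Fin n)) → iter φ l w ≡ concatMap (λ a → iter φ l [ a ]) w
  iter-concatMap l []      = iter-[] l
  iter-concatMap l (a ∷ w) = trans (iter-++ l [ a ] w) (cong (iter φ l [ a ] ++_) (iter-concatMap l w))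

  iter-suc : ∀ l (w : List (Fin n)) → iter φ (suc l) w ≡ iter φ l (apply φ w)
  iter-suc zero    w = refl
  iter-suc (suc l) w = cong (apply φ) (iter-suc l w)

  iter-suc-[_] : ∀ a l → iter φ (suc l) [ a ] ≡ iter φ l (toList (φ a))
  iter-suc-[ a ] l = trans (iter-suc l [ a ]) (cong (iter φ l) (++-identityʳ (toList (φ a))))

  length-apply : (w : List (Fin n)) → length (apply φ w) ≡ k * length w
  length-apply []      = sym (*-zeroʳ k)
  length-apply (a ∷ w) = begin
    length (toList (φ a) ++ apply φ w)         ≡⟨ length-++ (toList (φ a)) ⟩
    length (toList (φ a)) + length (apply φ w) ≡⟨ cong₂ _+_ (length-toList (φ a)) (length-apply w) ⟩
    k + k * length w                           ≡⟨ *-suc k (length w) ⟨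
    k * length (a ∷ w)                         ∎
    where open ≡-Reasoning

  length-iter : ∀ l (w : List (Fin n)) → length (iter φ l w) ≡ k ^ l * length w
  length-iter zero    w = sym (*-identityˡ (length w))
  length-iter (suc l) w = begin
    length (apply φ (iter φ l w)) ≡⟨ length-apply (iter φ l w) ⟩
    k * length (iter φ l w)      ≡⟨ cong (k *_) (length-iter l w) ⟩
    k * (k ^ l * length w)       ≡⟨ *-assoc k (k ^ l) (length w) ⟨
    k * k ^ l * length w         ∎
    where open ≡-Reasoning

module _ (φ : UniformMorphism n k) (h : Fin n → Fin m) where

  codedImage : ℕ → List (Fin n) → List (Fin m)
  codedImage l w = code h (iter φ l w)

  codedImage-concatMap : ∀ l (w : List (Fin n)) →
                         codedImage l w ≡ concatMap (λ a → codedImage l [ a ]) w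
  codedImage-concatMap l w = trans (cong (code h) (iter-concatMap φ l w))
                                   (map-concatMap h (λ a → iter φ l [ a ]) w)

  codedImage-suc-[_] : ∀ a l → codedImage (suc l) [ a ] ≡ codedImage l (toList (φ a))
  codedImage-suc-[ a ] l = cong (code h) (iter-suc-[_] φ a l)

  codedImage-sameLength : ∀ l a b → length (codedImage l [ a ]) ≡ length (codedImage l [ b ])
  codedImage-sameLength l a b = begin
    length (map h (iter φ l [ a ])) ≡⟨ length-map h (iter φ l [ a ]) ⟩
    length (iter φ l [ a ])         ≡⟨ length-iter φ l [ a ] ⟩
    k ^ l * 1                       ≡⟨ length-iter φ l [ b ] ⟨
    length (iter φ l [ b ])         ≡⟨ length-map h (iter φ l [ b ]) ⟨
    length (map h (iter φ l [ b ])) ∎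
    where open ≡-Reasoning

  Sim-suc⇒Pointwise : ∀ l b c → Sim φ h (suc l) b c → Pointwise (Sim φ h l) (φ b) (φ c)
  Sim-suc⇒Pointwise l b c b∼c =
    concatMap-toList-injective (λ a → codedImage l [ a ]) (codedImage-sameLength l) (φ b) (φ c) (begin
      concatMap (λ a → codedImage l [ a ]) (toList (φ b)) ≡⟨ codedImage-concatMap l (toList (φ b)) ⟨
      codedImage l (toList (φ b))                         ≡⟨ codedImage-suc-[ b ] l ⟨
      codedImage (suc l) [ b ]                            ≡⟨ b∼c ⟩
      codedImage (suc l) [ c ]                            ≡⟨ codedImage-suc-[ c ] l ⟩
      codedImage l (toList (φ c))                         ≡⟨ codedImage-concatMap l (toList (φ c)) ⟩
      concatMap (λ a → codedImage l [ a ]) (toList (φ c)) ∎)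
    where open ≡-Reasoning

  Pointwise⇒Sim-suc : ∀ l b c → Pointwise (Sim φ h l) (φ b) (φ c) → Sim φ h (suc l) b c
  Pointwise⇒Sim-suc l b c φb∼φc = begin
    codedImage (suc l) [ b ]                            ≡⟨ codedImage-suc-[ b ] l ⟩
    codedImage l (toList (φ b))                         ≡⟨ codedImage-concatMap l (toList (φ b)) ⟩
    concatMap (λ a → codedImage l [ a ]) (toList (φ b)) ≡⟨ concatMap-toList-cong (λ a → codedImage l [ a ]) φb∼φc ⟩
    concatMap (λ a → codedImage l [ a ]) (toList (φ c)) ≡⟨ codedImage-concatMap l (toList (φ c)) ⟨
    codedImage l (toList (φ c))                         ≡⟨ codedImage-suc-[ c ] l ⟨
    codedImage (suc l) [ c ]                            ∎
    where open ≡-Reasoning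

  Sim-suc-mono : ∀ l l′ → (∀ b c → Sim φ h l b c → Sim φ h l′ b c) →
                 ∀ b c → Sim φ h (suc l) b c → Sim φ h (suc l′) b c
  Sim-suc-mono l l′ ∼ₗ⇒∼ₗ′ b c b∼c =
    Pointwise⇒Sim-suc l′ b c (Pointwise.map (∼ₗ⇒∼ₗ′ _ _) (Sim-suc⇒Pointwise l b c b∼c))

  SameRel-Sim-suc : ∀ l l′ → SameRel (Sim φ h l) (Sim φ h l′) → SameRel (Sim φ h (suc l)) (Sim φ h (suc l′))
  SameRel-Sim-suc l l′ same b c =
    Sim-suc-mono l l′ (λ x y → proj₁ (same x y)) b c , Sim-suc-mono l′ l (λ x y → proj₂ (same x y)) b c

  SameRel-Sim-+ : ∀ r t → SameRel (Sim φ h r) (Sim φ h t) → ∀ p → SameRel (Sim φ h (p + r)) (Sim φ h (p + t))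
  SameRel-Sim-+ r t same zero    = same
  SameRel-Sim-+ r t same (suc p) = SameRel-Sim-suc (p + r) (p + t) (SameRel-Sim-+ r t same p)

lemma3 : (n m k : ℕ) (φ : UniformMorphism n k) (h : Fin n → Fin m) (r t : ℕ)
    → SameRel (Sim φ h r) (Sim φ h t)
    → (p : ℕ) → SameRel (Sim φ h (r + p)) (Sim φ h (t + p))
lemma3 n m k φ h r t same p rewrite +-comm r p | +-comm t p = SameRel-Sim-+ φ h r t same p
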